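{- Let $\mathcal{G}$ be an ADMG and $\mathcal{G}^m$ its projected MAG, and let $v,w$ be two vertices. Then (i) $v\to w$ in $\mathcal{G}^m$ if and only if $v\in\mathrm{tail}_{\mathcal{G}}(\{w\})$; and (ii) $v\leftrightarrow w$ in $\mathcal{G}^m$ if and only if $\{v,w\}\in\mathcal{H}(\mathcal{G})$.
   Context: An acyclic directed mixed graph (ADMG) $\mathcal{G}$ on a finite vertex set $\mathcal{V}$ has directed ($a\to b$) and bidirected ($a\leftrightarrow b$) edges and no directed cycle. $\mathrm{pa}_{\mathcal{G}}(v)=\{w:w\to v\}$, $\mathrm{an}_{\mathcal{G}}(v)$ ($\mathrm{de}_{\mathcal{G}}(v)$) is $v$ together with vertices having a directed path to (from) $v$, $\mathrm{dis}_{\mathcal{G}}(v)$ is $v$ together with vertices joined to $v$ by a path of bidirected edges; for sets take unions. For $W\subseteq\mathcal{V}$, $\mathcal{G}_W$ is the induced subgraph and $\mathrm{dis}_W(\cdot)$ the district in $\mathcal{G}_W$. A path is a sequence of distinct vertices, consecutive ones joined by an edge; a non-endpoint $w$ is a collider if both path edges at $w$ have an arrowhead at $w$; a collider path is one all of whose non-endpoints are colliders. $\mathrm{barren}_{\mathcal{G}}(W)=\{w\in W:\mathrm{de}_{\mathcal{G}}(w)\cap W=\{w\}\}$; a head is $H\subseteq\mathcal{V}$ with $\mathrm{barren}_{\mathcal{G}}(H)=H$ and $H$ contained in one district of $\mathcal{G}_{\mathrm{an}_{\mathcal{G}}(H)}$; $\mathcal{H}(\mathcal{G})$ is the set of heads;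 $\mathrm{tail}_{\mathcal{G}}(H)=(\mathrm{dis}_{\mathrm{an}_{\mathcal{G}}(H)}(H)\setminus H)\cup\mathrm{pa}_{\mathcal{G}}(\mathrm{dis}_{\mathrm{an}_{\mathcal{G}}(H)}(H))$. The projected graph $\mathcal{G}^m$ has vertex set $\mathcal{V}$; distinct $a,b$ are adjacent in $\mathcal{G}^m$ iff in $\mathcal{G}$ they are joined by a collider path all of whose non-endpoints lie in $\mathrm{an}_{\mathcal{G}}(\{a,b\})$; such an edge is $a\to b$ if $a\in\mathrm{an}_{\mathcal{G}}(b)$, $b\to a$ if $b\in\mathrm{an}_{\mathcal{G}}(a)$, and $a\leftrightarrow b$ otherwise. -}

module Defs where

open import Data.Nat using (ℕ)
open import Data.Fin using (Fin)
open import Data.Bool using (Bool; true; false; T)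
open import Data.List using (List; []; _∷_; _++_; [_])
open import Data.List.Relation.Unary.All using (All)
open import Data.List.Relation.Unary.Unique.Propositional using (Unique)
open import Data.Product using (Σ; ∃; _×_; _,_)
open import Data.Sum using (_⊎_)
open import Relation.Nullary using (¬_)
open import Relation.Binary.PropositionalEquality using (_≡_; _≢_)
open import Relation.Binary.Construct.Closure.ReflexiveTransitive using (Star)

VSet : ℕ → Set₁
VSet n = Fin n → Set

-- An acyclic directed mixed graph on vertex set Fin n.
-- dir a b = true  means  a → b ;  bi a b = true  means  a ↔ b.
record ADMG (n : ℕ) : Set where
  field
    dir : Fin n → Fin n → Bool
    bi  : Fin n → Fin n → Bool
    bi-sym     : ∀ a b → bi a b ≡ bi b a
    bi-irrefl  : ∀ a → bi a a ≡ false
    -- no directed cycle (this also excludes directed self-loops)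
    acyclic    : ∀ a b → T (dir a b) → ¬ Star (λ x y → T (dir x y)) b a

module _ {n : ℕ} (G : ADMG n) where
  open ADMG G

  _⇒_ : Fin n → Fin n → Set
  a ⇒ b = T (dir a b)

  _⟷_ : Fin n → Fin n → Set
  a ⟷ b = T (bi a b)

  _⇒*_ : Fin n → Fin n → Set
  a ⇒* b = Star _⇒_ a b

  an : VSet n → VSet n
  an W x = ∃ λ w → W w × (x ⇒* w)

  de : Fin n → VSet n
  de v x = v ⇒* x

  pa : VSet n → VSet n
  pa W x = ∃ λ w → W w × (x ⇒ w)

  BiStep : VSet n → Fin n → Fin n → Set
  BiStep W a b = W a × W b × (a ⟷ b)

  -- dis_W(U) : district of U in G_W (U is assumed ⊆ W)
  disIn : VSet n → VSet n → VSet n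
  disIn W U x = ∃ λ u → U u × Star (BiStep W) u x

  barren : VSet n → VSet n
  barren W w = W w × (∀ x → de w x → W x → x ≡ w)

  IsHead : VSet n → Set
  IsHead H =
    (∀ x → H x → barren H x) ×
    (∃ λ d → an H d × (∀ h → H h → Star (BiStep (an H)) d h))

  tail : VSet n → VSet n
  tail H x =
    (disIn (an H) H x × ¬ H x) ⊎ pa (disIn (an H) H) x

  _*→_ : Fin n → Fin n → Set
  a *→ b = (a ⇒ b) ⊎ (a ⟷ b)

  Adj : Fin n → Fin n → Set
  Adj a b = (a ⇒ b) ⊎ (b ⇒ a) ⊎ (a ⟷ b)

  -- edges along  c , rest , b  where every vertex except b is a collider
  -- (c is preceded by an edge with arrowhead at c)
  ColTail : Fin n → List (Fin n) → Fin n → Set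
  ColTail c []         b = b *→ c
  ColTail c (d ∷ rest) b = (c ⟷ d) × ColTail d rest b

  ColliderEdges : Fin n → List (Fin n) → Fin n → Set
  ColliderEdges a []         b = Adj a b
  ColliderEdges a (c ∷ rest) b = (a *→ c) × ColTail c rest b

  ColliderPath : Fin n → List (Fin n) → Fin n → Set
  ColliderPath a cs b = Unique (a ∷ cs ++ [ b ]) × ColliderEdges a cs b

  pair : Fin n → Fin n → VSet n
  pair a b x = (x ≡ a) ⊎ (x ≡ b)

  sing : Fin n → VSet n
  sing a x = x ≡ a

  AdjM : Fin n → Fin n → Set
  AdjM a b = a ≢ b × ∃ λ cs → ColliderPath a cs b × All (an (pair a b)) cs

  DirM : Fin n → Fin n → Set
  DirM a b = AdjM a b × an (sing b) a

  BiM : Fin n → Fin n → Set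
  BiM a b = AdjM a b × ¬ an (sing b) a × ¬ an (sing a) b

-- The whole proof rests on one translation between
-- collider paths and bidirected walks inside an ancestral set W:
--   * a bidirected walk in G_W between distinct vertices shortens to a simple
--     one, which is a collider path with interior in W; and
--   * conversely, a collider path a, cs, b with interior in W whose endpoint b
--     has no child in W starts with an edge a *→ c and then runs from c to b
--     along bidirected edges inside W (every interior vertex is a collider,
--     so every edge after the first is bidirected or points into b).
module Submission where

open import Defs
open import Data.Nat using (ℕ)
open import Data.Fin using (Fin; _≟_)
open import Data.Product using (_×_; _,_; ∃; proj₂)
open import Data.Sum using (inj₁; inj₂; swap)
open import Data.Bool using (T)
open import Data.Empty using (⊥-elim)
open import Data.List using (List; []; _∷_; _++_; [_])
open import Data.List.Relation.Unary.All using (All; []; _∷_)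
import Data.List.Relation.Unary.All as All
open import Data.List.Relation.Unary.All.Properties using (¬Any⇒All¬)
open import Data.List.Relation.Unary.Any using (here; there)
open import Data.List.Relation.Unary.AllPairs using ([]; _∷_)
open import Data.List.Relation.Unary.Unique.Propositional using (Unique)
open import Data.List.Membership.Propositional using (_∈_)
open import Function.Bundles using (_⇔_; mk⇔; Equivalence)
open import Relation.Nullary using (¬_; yes; no)
open import Relation.Unary using (_⊆_)
open import Relation.Binary.Definitions using (DecidableEquality)
open import Relation.Binary.PropositionalEquality using (_≡_; _≢_; refl; sym; subst)
open import Relation.Binary.Construct.Closure.ReflexiveTransitive
  using (Star; ε; _◅_; _◅◅_; reverse)

module SimplePaths {A : Set} (_≟ᴬ_ : DecidableEquality A) where
  open import Data.List.Membership.DecPropositional _≟ᴬ_ using (_∈?_)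

  Path : (A → A → Set) → A → List A → A → Set
  Path R a []       b = R a b
  Path R a (c ∷ cs) b = R a c × Path R c cs b

  SimplePath : (A → A → Set) → A → A → Set
  SimplePath R a b = ∃ λ cs → Path R a cs b × Unique (a ∷ cs ++ [ b ])

  onPath⇒star : ∀ {R a} cs {b y} → Path R a cs b → y ∈ (a ∷ cs ++ [ b ]) → Star R y b
  onPath⇒star []       r       (here refl)         = r ◅ ε
  onPath⇒star []       r       (there (here refl)) = ε
  onPath⇒star (c ∷ cs) (r , p) (here refl)         = r ◅ onPath⇒star cs p (here refl)
  onPath⇒star (c ∷ cs) (r , p) (there m)           = onPath⇒star cs p m

  suffix : ∀ {R c} cs {b y} → Path R c cs b → Unique (c ∷ cs ++ [ b ]) →
           y ∈ (c ∷ cs ++ [ b ]) → y ≢ b → SimplePath R y b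
  suffix cs       p       u       (here refl)         y≢b = cs , p , u
  suffix []       p       u       (there (here refl)) y≢b = ⊥-elim (y≢b refl)
  suffix (d ∷ cs) (r , p) (_ ∷ u) (there m)           y≢b = suffix cs p u m y≢b

  -- Inductively, a R c followed by a simple path from c either already
  -- contains a (take its suffix) or can be extended by a.
  shorten : ∀ {R a b} → Star R a b → a ≢ b → SimplePath R a b
  shorten ε a≢b = ⊥-elim (a≢b refl)
  shorten {a = a} {b} (_◅_ {j = c} r rest) a≢b with c ≟ᴬ b
  ... | yes refl = [] , r , (a≢b ∷ []) ∷ [] ∷ []
  ... | no c≢b with shorten rest c≢b
  ...   | cs , p , u with a ∈? (c ∷ cs ++ [ b ])
  ...     | yes a∈ = suffix cs p u a∈ a≢b
  ...     | no  a∉ = c ∷ cs , (r , p) , ¬Any⇒All¬ _ a∉ ∷ u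

module ADMGFacts {n : ℕ} (G : ADMG n) where
  open ADMG G
  open SimplePaths (_≟_ {n}) public

  _⇒ᴳ_ _⟷ᴳ_ _⇒ᴳ*_ _*→ᴳ_ : Fin n → Fin n → Set
  _⇒ᴳ_  = _⇒_ G
  _⟷ᴳ_  = _⟷_ G
  _⇒ᴳ*_ = _⇒*_ G
  _*→ᴳ_ = _*→_ G

  BiWalk : VSet n → Fin n → Fin n → Set
  BiWalk W = Star (BiStep G W)

  no-cycle : ∀ {a b} → a ⇒ᴳ b → ¬ (b ⇒ᴳ* a)
  no-cycle {a} {b} = acyclic a b

  ⟷-sym : ∀ {a b} → a ⟷ᴳ b → b ⟷ᴳ a
  ⟷-sym {a} {b} = subst T (bi-sym a b)

  an-⊆ : ∀ {U W : VSet n} → U ⊆ an G W → an G U ⊆ an G W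
  an-⊆ U⊆anW (u , Uu , x⇒*u) with U⊆anW Uu
  ... | w , Ww , u⇒*w = w , Ww , x⇒*u ◅◅ u⇒*w

  an-parent : ∀ {U : VSet n} {a x} → a ⇒ᴳ x → an G U x → an G U a
  an-parent a⇒x (u , Uu , x⇒*u) = u , Uu , a⇒x ◅ x⇒*u

  Childless : VSet n → Fin n → Set
  Childless W b = ∀ {x} → W x → ¬ (b ⇒ᴳ x)

  -- A vertex a that is not an ancestor of b has no child among the ancestors
  -- of any U ⊆ {a, b}: such a child would close a cycle or reach b.
  childless-in-an-pair : ∀ {U : VSet n} {a b} → U ⊆ pair G a b →
                         ¬ an G (sing G b) a → Childless (an G U) a
  childless-in-an-pair U⊆ab a∉anb (u , Uu , x⇒*u) a⇒x with U⊆ab Uu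
  ... | inj₁ refl = no-cycle a⇒x x⇒*u
  ... | inj₂ refl = a∉anb (u , refl , a⇒x ◅ x⇒*u)

  reverse-biWalk : ∀ {W a b} → BiWalk W a b → BiWalk W b a
  reverse-biWalk = reverse λ (Wa , Wb , a⟷b) → Wb , Wa , ⟷-sym a⟷b

  biWalk-stays : ∀ {W : VSet n} {a b} → W a → BiWalk W a b → W b
  biWalk-stays Wa ε                  = Wa
  biWalk-stays Wa ((_ , Wc , _) ◅ s) = biWalk-stays Wc s

  biPath-interior : ∀ {W a} cs {b} → Path (BiStep G W) a cs b → All W cs
  biPath-interior []       _                  = []
  biPath-interior (c ∷ cs) ((_ , Wc , _) , p) = Wc ∷ biPath-interior cs p

  biPath-colTail : ∀ {W c} rest {b} → Path (BiStep G W) c rest b → ColTail G c rest b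
  biPath-colTail []         (_ , _ , c⟷b)       = inj₂ (⟷-sym c⟷b)
  biPath-colTail (d ∷ rest) ((_ , _ , c⟷d) , p) = c⟷d , biPath-colTail rest p

  biPath-colliderEdges : ∀ {W a} cs {b} → Path (BiStep G W) a cs b → ColliderEdges G a cs b
  biPath-colliderEdges []       (_ , _ , a⟷b)       = inj₂ (inj₂ a⟷b)
  biPath-colliderEdges (c ∷ cs) ((_ , _ , a⟷c) , p) = inj₂ a⟷c , biPath-colTail cs p

  biWalk⇒colliderPath : ∀ {W a b} → a ≢ b → BiWalk W a b →
                        ∃ λ cs → ColliderPath G a cs b × All W cs
  biWalk⇒colliderPath a≢b s with shorten s a≢b
  ... | cs , p , u = cs , (u , biPath-colliderEdges cs p) , biPath-interior cs p

  -- The converse direction.  If b has no child in W, the tail of a collider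
  -- path c, rest, b inside W cannot end in b → c, so it is bidirected.
  colTail⇒biWalk : ∀ {W b} c rest → W b → Childless W b → All W (c ∷ rest) →
                   ColTail G c rest b → BiWalk W c b
  colTail⇒biWalk c []         Wb b-cl (Wc ∷ []) (inj₁ b⇒c) = ⊥-elim (b-cl Wc b⇒c)
  colTail⇒biWalk c []         Wb b-cl (Wc ∷ []) (inj₂ b⟷c) = (Wc , Wb , ⟷-sym b⟷c) ◅ ε
  colTail⇒biWalk c (d ∷ rest) Wb b-cl (Wc ∷ Ws) (c⟷d , ct) =
    (Wc , All.head Ws , c⟷d) ◅ colTail⇒biWalk d rest Wb b-cl Ws ct

  colliderEdges⇒entry : ∀ {W a b} cs → W b → Childless W b → ¬ (b ⇒ᴳ a) →
                        All W cs → ColliderEdges G a cs b →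
                        ∃ λ c → W c × (a *→ᴳ c) × BiWalk W c b
  colliderEdges⇒entry []      Wb _    _    _  (inj₁ a⇒b)        = _ , Wb , inj₁ a⇒b , ε
  colliderEdges⇒entry []      Wb _    b↛a _  (inj₂ (inj₁ b⇒a)) = ⊥-elim (b↛a b⇒a)
  colliderEdges⇒entry []      Wb _    _    _  (inj₂ (inj₂ a⟷b)) = _ , Wb , inj₂ a⟷b , ε
  colliderEdges⇒entry (c ∷ rest) Wb b-cl _ Wcs (a*→c , ct) =
    c , All.head Wcs , a*→c , colTail⇒biWalk c rest Wb b-cl Wcs ct

module Lemma {n : ℕ} (G : ADMG n) (v w : Fin n) (v≢w : v ≢ w) where
  open ADMGFacts G
  open import Data.List.Membership.DecPropositional (_≟_ {n}) using (_∈?_)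

  H : VSet n
  H = pair G v w

  Aw AH : VSet n
  Aw = an G (sing G w)
  AH = an G H

  w∈Aw : Aw w
  w∈Aw = w , refl , ε

  v∈AH : AH v
  v∈AH = v , inj₁ refl , ε

  w∈AH : AH w
  w∈AH = w , inj₂ refl , ε

  Aw⊆AH : Aw ⊆ AH
  Aw⊆AH = an-⊆ λ { refl → w∈AH }

  w-childless-in-Aw : Childless Aw w
  w-childless-in-Aw (_ , refl , x⇒*w) w⇒x = no-cycle w⇒x x⇒*w

  AH⊆Aw : Aw v → AH ⊆ Aw
  AH⊆Aw v∈Aw = an-⊆ λ { (inj₁ refl) → v∈Aw ; (inj₂ refl) → w∈Aw }

  district⇒adjacent : BiWalk Aw w v → AdjM G v w
  district⇒adjacent w-to-v with biWalk⇒colliderPath v≢w (reverse-biWalk w-to-v)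
  ... | cs , path , inAw = v≢w , cs , path , All.map Aw⊆AH inAw

  -- The same holds if v is a parent of a vertex x of that district: either
  -- x = w, or v already lies on the simple bidirected path from x to w, or
  -- v → x followed by that path is a collider path.
  parent-of-district⇒adjacent : ∀ {x} → BiWalk Aw w x → v ⇒ᴳ x → AdjM G v w
  parent-of-district⇒adjacent {x} w-to-x v⇒x with x ≟ w
  ... | yes refl = v≢w , [] , ((v≢w ∷ []) ∷ [] ∷ [] , inj₁ v⇒x) , []
  ... | no x≢w with shorten (reverse-biWalk w-to-x) x≢w
  ...   | cs , x-to-w , unique with v ∈? (x ∷ cs ++ [ w ])
  ...     | yes v∈ = district⇒adjacent (reverse-biWalk (onPath⇒star cs x-to-w v∈))
  ...     | no  v∉ = v≢w , x ∷ cs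
                   , (¬Any⇒All¬ _ v∉ ∷ unique , inj₁ v⇒x , biPath-colTail cs x-to-w)
                   , All.map Aw⊆AH (biWalk-stays w∈Aw w-to-x ∷ biPath-interior cs x-to-w)

  pair-barren⇔ : (∀ x → H x → barren G H x) ⇔ (¬ Aw v × ¬ an G (sing G v) w)
  pair-barren⇔ = mk⇔ to from
    where
    to : (∀ x → H x → barren G H x) → ¬ Aw v × ¬ an G (sing G v) w
    to bar =
        (λ { (_ , refl , v⇒*w) → v≢w (sym (proj₂ (bar v (inj₁ refl)) w v⇒*w (inj₂ refl))) })
      , (λ { (_ , refl , w⇒*v) → v≢w (proj₂ (bar w (inj₂ refl)) v w⇒*v (inj₁ refl)) })
    from : ¬ Aw v × ¬ an G (sing G v) w → ∀ x → H x → barren G H x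
    from (v∉Aw , w∉Av) x Hx = Hx , below x Hx
      where
      below : ∀ x → H x → ∀ y → de G x y → H y → y ≡ x
      below _ (inj₁ refl) _ _     (inj₁ refl) = refl
      below _ (inj₁ refl) y v⇒*w (inj₂ refl) = ⊥-elim (v∉Aw (y , refl , v⇒*w))
      below _ (inj₂ refl) y w⇒*v (inj₁ refl) = ⊥-elim (w∉Av (y , refl , w⇒*v))
      below _ (inj₂ refl) _ _     (inj₂ refl) = refl

  -- Part (i), "only if": the collider path from v enters an(w) at some c
  -- with v → c (v is a parent of the district) or v ↔ c (v is in it).
  dir⇒tail : DirM G v w → tail G (sing G w) v
  dir⇒tail ((_ , cs , (_ , edges) , inAH) , v∈Aw@(_ , refl , v⇒*w))
    with colliderEdges⇒entry cs w∈Aw w-childless-in-Aw (λ w⇒v → no-cycle w⇒v v⇒*w)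
                             (All.map (AH⊆Aw v∈Aw) inAH) edges
  ... | c , _    , inj₁ v⇒c , c-to-w = inj₂ (c , (w , refl , reverse-biWalk c-to-w) , v⇒c)
  ... | c , c∈Aw , inj₂ v⟷c , c-to-w =
    inj₁ ((w , refl , reverse-biWalk c-to-w ◅◅ (c∈Aw , v∈Aw , ⟷-sym v⟷c) ◅ ε) , v≢w)

  tail⇒dir : tail G (sing G w) v → DirM G v w
  tail⇒dir (inj₁ ((_ , refl , w-to-v) , _)) =
    district⇒adjacent w-to-v , biWalk-stays w∈Aw w-to-v
  tail⇒dir (inj₂ (x , (_ , refl , w-to-x) , v⇒x)) =
    parent-of-district⇒adjacent w-to-x v⇒x , an-parent v⇒x (biWalk-stays w∈Aw w-to-x)

  -- Part (ii), "if": a common district of G_{an(v,w)} yields a bidirected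
  -- walk from v to w there, hence a collider path.
  head⇒bi : IsHead G H → BiM G v w
  head⇒bi (bar , _ , _ , reach) =
    (v≢w , biWalk⇒colliderPath v≢w v-to-w) , Equivalence.to pair-barren⇔ bar
    where
    v-to-w : BiWalk AH v w
    v-to-w = reverse-biWalk (reach v (inj₁ refl)) ◅◅ reach w (inj₂ refl)

  -- Part (ii), "only if": v has no child in an(v,w), so the collider path
  -- starts with v ↔ c and continues bidirected to w; v is the district root.
  bi⇒head : BiM G v w → IsHead G H
  bi⇒head ((_ , cs , (_ , edges) , inAH) , v∉Aw , w∉Av) =
    Equivalence.from pair-barren⇔ (v∉Aw , w∉Av) , v , v∈AH , reach
    where
    v-to-w : BiWalk AH v w
    v-to-w with colliderEdges⇒entry cs w∈AH (childless-in-an-pair swap w∉Av)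
                                    (λ w⇒v → w∉Av (v , refl , w⇒v ◅ ε)) inAH edges
    ... | c , c∈AH , inj₁ v⇒c , _      = ⊥-elim (childless-in-an-pair (λ h → h) v∉Aw c∈AH v⇒c)
    ... | c , c∈AH , inj₂ v⟷c , c-to-w = (v∈AH , c∈AH , v⟷c) ◅ c-to-w
    reach : ∀ h → H h → BiWalk AH v h
    reach _ (inj₁ refl) = ε
    reach _ (inj₂ refl) = v-to-w

lemma3p7 : ∀ {n : ℕ} (G : ADMG n) (v w : Fin n) → v ≢ w →
    (DirM G v w ⇔ tail G (sing G w) v) × (BiM G v w ⇔ IsHead G (pair G v w))
lemma3p7 G v w v≢w = mk⇔ dir⇒tail tail⇒dir , mk⇔ bi⇒head head⇒bi
  where open Lemma G v w v≢w
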